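{- Let $\mathcal{C}=\{c_1<c_2<\cdots\}$ be an infinite completely greedy coin set. Then \[ \limsup_{N \rightarrow \infty} \frac{ \mathrm{cost}(N \, ; \, \mathcal{C}) }{ \left( \lfloor \log_{2}(N-1) \rfloor + 2 \right) N } \ge \frac{1}{2}. \]
   Context: A coin set is a set of positive integers containing $1$; a sub-coin set is a subset containing $1$. A representation of a positive integer $m$ in $\mathcal{C}$ is $m=\sum_{c\in\mathcal{C}}\alpha_c c$ with $\alpha_c\in\mathbb{N}$; it is minimal if $\sum_c\alpha_c$ is minimized. The greedy representation repeatedly subtracts the largest coin not exceeding the remaining amount. A finite coin set is greedy if the greedy representation is minimal for every positive integer, and completely greedy if all its sub-coin sets are greedy. An infinite coin set (one with infinitely many elements, enumerated increasingly) is completely greedy if for every finite $n$ its first $n$ elements form a completely greedy coin set. $\mathrm{opt}(k;\mathcal{C})$ is the number of coins in a minimal representation of $k$, and $\mathrm{cost}(N;\mathcal{C}) := \sum_{k=1}^{N} \mathrm{opt}(k;\mathcal{C})$. -}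

module Defs where

open import Data.Nat using (ℕ; zero; suc; _+_; _*_; _∸_; _≤_; _<_)
open import Data.Nat.Logarithm using (⌊log₂_⌋)
open import Data.List using (List; []; _∷_; length)
open import Data.Nat.ListAction using (sum)
open import Data.List.Relation.Unary.All using (All)
open import Data.Fin using (Fin; toℕ)
open import Data.Fin.Subset using (Subset; _∈_)
open import Data.Product using (Σ; ∃; _×_)
open import Relation.Binary.PropositionalEquality using (_≡_)

CoinPred : Set₁
CoinPred = ℕ → Set

-- Its number of coins is its length
-- (equivalent to m = Σ α_c c with α_c = multiplicity of c, Σ α_c = length).
Rep : CoinPred → ℕ → List ℕ → Set
Rep P m r = All P r × sum r ≡ m

data GreedyRep (P : CoinPred) : ℕ → List ℕ → Set where
  done : GreedyRep P 0 []
  step : ∀ {m x r} → 0 < m → P x → x ≤ m →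
         (∀ y → P y → y ≤ m → y ≤ x) →
         GreedyRep P (m ∸ x) r → GreedyRep P m (x ∷ r)

IsGreedy : CoinPred → Set
IsGreedy P = ∀ m → 1 ≤ m → ∀ g → GreedyRep P m g →
             ∀ r → Rep P m r → length g ≤ length r

StrictlyIncreasing : (ℕ → ℕ) → Set
StrictlyIncreasing c = ∀ i → c i < c (suc i)

InfCoinSet : (ℕ → ℕ) → Set
InfCoinSet c = c 0 ≡ 1 × StrictlyIncreasing c

InSeq : (ℕ → ℕ) → CoinPred
InSeq c x = ∃ λ i → c i ≡ x

InSub : (ℕ → ℕ) → {n : ℕ} → Subset n → CoinPred
InSub c {n} s x = Σ (Fin n) λ i → i ∈ s × c (toℕ i) ≡ x

FirstCompletelyGreedy : (ℕ → ℕ) → ℕ → Set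
FirstCompletelyGreedy c n = (s : Subset n) → InSub c s 1 → IsGreedy (InSub c s)

CompletelyGreedy : (ℕ → ℕ) → Set
CompletelyGreedy c = ∀ n → FirstCompletelyGreedy c n

IsOpt : CoinPred → ℕ → ℕ → Set
IsOpt P k m = (∃ λ r → Rep P k r × length r ≡ m) × (∀ r → Rep P k r → m ≤ length r)

cost : (ℕ → ℕ) → ℕ → ℕ
cost o zero = 0
cost o (suc N) = cost o N + o (suc N)

denom : ℕ → ℕ
denom N = (⌊log₂ (N ∸ 1) ⌋ + 2) * N

-- Subadditivity of opt lets one pair k with N − k in cost N, so N ⋅ opt N ≤ 2 ⋅ cost N, and it
-- suffices to find arbitrarily large N with opt N ≥ (1 − 1/K)(⌊log₂ (N − 1)⌋ + 2).  Complete
-- greediness makes every three-coin set {1, c j, c (j + 1)} greedy, which yields some l ≥ 1 with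
-- (l + 1) c j ≤ c (j + 1) + 2 and c (j + 1) ≤ 2^l c j.  Start at a coin c a ≤ 2^(A + 1) that is
-- large compared with D = K (A + 2), and take l copies of c j for each a ≤ j < a + D.  The
-- additive errors, at most 2 per step, stay below c a, so the resulting amount N < c (a + D) is
-- represented greedily, hence optimally, by at least log₂ (c (a + D) / c a) coins, while
-- N + 1 ≥ 2^D.  Thus opt N ≥ ⌊log₂ (N − 1)⌋ + 2 − (A + 2), and
-- A + 2 = D / K ≤ (⌊log₂ (N − 1)⌋ + 2) / K.

module Submission where

open import Defs
open import Function using (_∘_)
open import Data.Nat using (ℕ; zero; suc; _+_; _*_; _∸_; _^_; _≤_; _<_; _≤′_; ≤′-refl; ≤′-step; z≤n; s≤s; z<s; _<?_; _≤?_; ⌊_/2⌋; >-nonZero)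
open import Data.Nat.Properties
open import Data.Nat.Logarithm using (⌊log₂_⌋; ⌊log₂⌋-mono-≤; ⌊log₂⌊n/2⌋⌋≡⌊log₂n⌋∸1; ⌊log₂[2^n]⌋≡n)
open import Data.Product using (∃; _×_; _,_; proj₁; proj₂)
open import Data.Sum using (_⊎_; inj₁; inj₂)
open import Data.List using (List; []; _∷_; length; _++_; replicate)
open import Data.List.Properties using (length-++; length-replicate; ++-identityʳ)
open import Data.Nat.ListAction using (sum)
open import Data.Nat.ListAction.Properties using (sum-++)
open import Data.List.Relation.Unary.All using (All; []; _∷_)
open import Data.List.Relation.Unary.All.Properties using (++⁺; replicate⁺)
open import Data.Fin as Fin using (toℕ; fromℕ; fromℕ<; inject₁)
open import Data.Fin.Properties using (toℕ-fromℕ; toℕ-fromℕ<; toℕ-inject₁)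
open import Data.Fin.Subset using (Subset; ⊤; ⁅_⁆; _∪_)
open import Data.Fin.Subset.Properties using (∈⊤; x∈⁅x⁆; x∈⁅y⁆⇒x≡y; x∈p∪q⁺; x∈p∪q⁻)
open import Relation.Nullary using (yes; no)
open import Relation.Nullary.Negation using (contradiction)
open import Relation.Binary.PropositionalEquality
open import Algebra.Properties.CommutativeSemigroup +-commutativeSemigroup using (interchange)

Sum : (ℕ → ℕ) → ℕ → ℕ
Sum f zero    = 0
Sum f (suc n) = f 0 + Sum (f ∘ suc) n

Sum-snoc : ∀ f n → Sum f (suc n) ≡ Sum f n + f n
Sum-snoc f zero    = +-comm (f 0) 0
Sum-snoc f (suc n) = trans (cong (f 0 +_) (Sum-snoc (f ∘ suc) n)) (sym (+-assoc (f 0) _ _))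

Sum-const : ∀ x n → Sum (λ _ → x) n ≡ n * x
Sum-const x zero    = refl
Sum-const x (suc n) = cong (x +_) (Sum-const x n)

Sum-+ : ∀ f g n → Sum (λ j → f j + g j) n ≡ Sum f n + Sum g n
Sum-+ f g zero    = refl
Sum-+ f g (suc n) = trans (cong (f 0 + g 0 +_) (Sum-+ (f ∘ suc) (g ∘ suc) n))
                          (interchange (f 0) (g 0) (Sum (f ∘ suc) n) (Sum (g ∘ suc) n))

Sum-mono-≤ : ∀ {f g} n → (∀ j → j < n → f j ≤ g j) → Sum f n ≤ Sum g n
Sum-mono-≤ zero    f≤g = z≤n
Sum-mono-≤ (suc n) f≤g = +-mono-≤ (f≤g 0 z<s) (Sum-mono-≤ n (λ j j<n → f≤g (suc j) (s≤s j<n)))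

cost≡Sum : ∀ o n → cost o n ≡ Sum (o ∘ suc) n
cost≡Sum o zero    = refl
cost≡Sum o (suc n) = trans (cong (_+ o (suc n)) (cost≡Sum o n)) (sym (Sum-snoc (o ∘ suc) n))

cost≡reversed-Sum : ∀ o n → cost o n ≡ Sum (λ j → o (n ∸ j)) n
cost≡reversed-Sum o zero    = refl
cost≡reversed-Sum o (suc n) = trans (+-comm (cost o n) (o (suc n))) (cong (o (suc n) +_) (cost≡reversed-Sum o n))

Subadditive : (ℕ → ℕ) → Set
Subadditive o = ∀ {i j} → 1 ≤ i → 1 ≤ j → o (i + j) ≤ o i + o j

2*x≡x+x : ∀ x → 2 * x ≡ x + x
2*x≡x+x x = cong (x +_) (+-identityʳ x)

-- Pair the k-th summand of cost o N with the (N − k)-th.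
N*o[N]≤2*cost[N] : ∀ {o} → Subadditive o → ∀ N → N * o N ≤ 2 * cost o N
N*o[N]≤2*cost[N]         sub zero    = z≤n
N*o[N]≤2*cost[N] {o = o} sub (suc m) = begin
  suc m * o (suc m)                                    ≡⟨ +-comm (o (suc m)) (m * o (suc m)) ⟩
  m * o (suc m) + o (suc m)                            ≡⟨ cong (_+ o (suc m)) (Sum-const (o (suc m)) m) ⟨
  Sum (λ _ → o (suc m)) m + o (suc m)                  ≤⟨ +-monoˡ-≤ (o (suc m)) (Sum-mono-≤ m split) ⟩
  Sum (λ j → o (suc j) + o (m ∸ j)) m + o (suc m)      ≡⟨ cong (_+ o (suc m)) (Sum-+ (o ∘ suc) (λ j → o (m ∸ j)) m) ⟩
  Sum (o ∘ suc) m + Sum (λ j → o (m ∸ j)) m + o (suc m) ≡⟨ cong₂ (λ x y → x + y + o (suc m)) (cost≡Sum o m) (cost≡reversed-Sum o m) ⟨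
  cost o m + cost o m + o (suc m)                      ≤⟨ +-monoʳ-≤ (cost o m + cost o m) (m≤m+n (o (suc m)) (o (suc m))) ⟩
  cost o m + cost o m + (o (suc m) + o (suc m))        ≡⟨ interchange (cost o m) (cost o m) (o (suc m)) (o (suc m)) ⟩
  cost o (suc m) + cost o (suc m)                      ≡⟨ 2*x≡x+x (cost o (suc m)) ⟨
  2 * cost o (suc m)                                   ∎
  where
  open ≤-Reasoning
  split : ∀ j → j < m → o (suc m) ≤ o (suc j) + o (m ∸ j)
  split j j<m = subst (λ k → o k ≤ o (suc j) + o (m ∸ j)) (cong suc (m+[n∸m]≡n (<⇒≤ j<m)))
                      (sub (s≤s z≤n) (m<n⇒0<n∸m j<m))

IsOpt-subadditive : ∀ {P o} → (∀ k → 1 ≤ k → IsOpt P k (o k)) → Subadditive o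
IsOpt-subadditive {o = o} opt {i} {j} 1≤i 1≤j
  with proj₁ (opt i 1≤i) | proj₁ (opt j 1≤j)
... | r , (r∈P , Σr≡i) , |r|≡oi | s , (s∈P , Σs≡j) , |s|≡oj =
  subst (o (i + j) ≤_) (trans (length-++ r) (cong₂ _+_ |r|≡oi |s|≡oj))
    (proj₂ (opt (i + j) (≤-trans 1≤i (m≤m+n i j))) (r ++ s)
      (++⁺ r∈P s∈P , trans (sum-++ r s) (cong₂ _+_ Σr≡i Σs≡j)))

module Increasing {c : ℕ → ℕ} (c-inc : StrictlyIncreasing c) where

  mono-≤ : ∀ {i j} → i ≤ j → c i ≤ c j
  mono-≤ {i} i≤j = go (≤⇒≤′ i≤j)
    where
    go : ∀ {j} → i ≤′ j → c i ≤ c j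
    go ≤′-refl       = ≤-refl
    go (≤′-step i≤j) = ≤-trans (go i≤j) (<⇒≤ (c-inc _))

  cancel-< : ∀ {i j} → c i < c j → i < j
  cancel-< {i} {j} ci<cj with i <? j
  ... | yes i<j = i<j
  ... | no  i≮j = contradiction ci<cj (≤⇒≯ (mono-≤ (≮⇒≥ i≮j)))

  n<c[n] : 1 ≤ c 0 → ∀ n → n < c n
  n<c[n] 1≤c₀ zero    = 1≤c₀
  n<c[n] 1≤c₀ (suc n) = <-≤-trans (s≤s (n<c[n] 1≤c₀ n)) (c-inc n)

GreedyRep-replicate : ∀ {P x S g} l → 1 ≤ x → P x → (∀ y → P y → y ≤ l * x + S → y ≤ x) →
                      GreedyRep P S g → GreedyRep P (l * x + S) (replicate l x ++ g)
GreedyRep-replicate zero    1≤x x∈P maximal greedy = greedy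
GreedyRep-replicate {P} {x} {S} {g} (suc l) 1≤x x∈P maximal greedy =
  step (≤-trans 1≤x x≤m) x∈P x≤m maximal
    (subst (λ m → GreedyRep P m (replicate l x ++ g)) (sym m∸x≡)
      (GreedyRep-replicate l 1≤x x∈P (λ y y∈P y≤ → maximal y y∈P (≤-trans y≤ below-m)) greedy))
  where
  x≤m : x ≤ x + l * x + S
  x≤m = ≤-trans (m≤m+n x (l * x)) (m≤m+n (x + l * x) S)
  below-m : l * x + S ≤ x + l * x + S
  below-m = ≤-trans (m≤n+m (l * x + S) x) (≤-reflexive (sym (+-assoc x (l * x) S)))
  m∸x≡ : x + l * x + S ∸ x ≡ l * x + S
  m∸x≡ = trans (cong (_∸ x) (+-assoc x (l * x) S)) (m+n∸m≡n x (l * x + S))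

GreedyRep-ones : ∀ {P} r → P 1 → (∀ y → P y → y ≤ r → y ≤ 1) → GreedyRep P r (replicate r 1)
GreedyRep-ones {P} r 1∈P maximal =
  subst₂ (GreedyRep P) r*1+0≡r (++-identityʳ (replicate r 1))
    (GreedyRep-replicate r ≤-refl 1∈P (λ y y∈P y≤ → maximal y y∈P (≤-trans y≤ (≤-reflexive r*1+0≡r))) done)
  where
  r*1+0≡r : r * 1 + 0 ≡ r
  r*1+0≡r = trans (+-identityʳ (r * 1)) (*-identityʳ r)

-- Compare the greedy representation b + ((q + 1)a − b) ⋅ 1 of (q + 1)a with q + 1 copies of a.
three-coin-bound : ∀ {P a b q} → IsGreedy P → P 1 → P a → P b →
                   (∀ y → P y → y ≡ 1 ⊎ y ≡ a ⊎ y ≡ b) → a < b →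
                   q * a < b → b ≤ suc q * a → suc q * a ≤ b + q
three-coin-bound {P} {a} {b} {q} greedy 1∈P a∈P b∈P coins a<b qa<b b≤X = begin
  X             ≡⟨ m+[n∸m]≡n b≤X ⟨
  b + t         ≤⟨ +-monoʳ-≤ b (≤-pred |greedy|≤|opt|) ⟩
  b + q         ∎
  where
  open ≤-Reasoning
  X = suc q * a
  t = X ∸ b
  t<a : t < a
  t<a = +-cancelˡ-< b t a (begin-strict
    b + t  ≡⟨ m+[n∸m]≡n b≤X ⟩
    a + q * a <⟨ +-monoʳ-< a qa<b ⟩
    a + b  ≡⟨ +-comm a b ⟩
    b + a  ∎)
  ones-below-a : ∀ y → P y → y ≤ t → y ≤ 1
  ones-below-a y y∈P y≤t with coins y y∈P
  ... | inj₁ y≡1        = ≤-reflexive y≡1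
  ... | inj₂ (inj₁ y≡a) = contradiction (≤-<-trans y≤t t<a) (<-irrefl y≡a)
  ... | inj₂ (inj₂ y≡b) = contradiction (<-≤-trans (≤-<-trans y≤t t<a) (<⇒≤ a<b)) (<-irrefl y≡b)
  b-largest : ∀ y → P y → y ≤ X → y ≤ b
  b-largest y y∈P _ with coins y y∈P
  ... | inj₁ y≡1        = ≤-trans (≤-reflexive y≡1) (≤-trans (s≤s z≤n) a<b)
  ... | inj₂ (inj₁ y≡a) = ≤-trans (≤-reflexive y≡a) (<⇒≤ a<b)
  ... | inj₂ (inj₂ y≡b) = ≤-reflexive y≡b
  greedy-X : GreedyRep P X (b ∷ replicate t 1)
  greedy-X = step (≤-trans (≤-trans (s≤s z≤n) a<b) b≤X) b∈P b≤X b-largest (GreedyRep-ones t 1∈P ones-below-a)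
  |greedy|≤|opt| : suc t ≤ suc q
  |greedy|≤|opt| = subst₂ (λ m n → suc m ≤ n) (length-replicate t) (length-replicate (suc q))
    (greedy X (≤-trans (≤-trans (s≤s z≤n) a<b) b≤X) _ greedy-X (replicate (suc q) a)
      (replicate⁺ (suc q) a∈P , sum-replicate (suc q) a))
    where
    sum-replicate : ∀ m x → sum (replicate m x) ≡ m * x
    sum-replicate zero    x = refl
    sum-replicate (suc m) x = cong (x +_) (sum-replicate m x)

n<2^n : ∀ n → n < 2 ^ n
n<2^n zero    = s≤s z≤n
n<2^n (suc n) = ≤-trans (+-mono-≤ (m^n>0 2 n) (n<2^n n)) (≤-reflexive (sym (2*x≡x+x (2 ^ n))))

2+n≤2^n : ∀ n → 2 ≤ n → 2 + n ≤ 2 ^ n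
2+n≤2^n (suc zero)          (s≤s ())
2+n≤2^n (suc (suc zero))    _ = ≤-refl
2+n≤2^n (suc (suc (suc n))) _ =
  ≤-trans (+-mono-≤ (m^n>0 2 (2 + n)) (2+n≤2^n (suc (suc n)) (s≤s (s≤s z≤n)))) (≤-reflexive (sym (2*x≡x+x (2 ^ (2 + n)))))

multiple-bracket : ∀ {a} b → 1 ≤ a → 1 ≤ b → ∃ λ q → q * a < b × b ≤ suc q * a
multiple-bracket (suc zero)    1≤a _ = 0 , s≤s z≤n , ≤-trans 1≤a (≤-reflexive (sym (+-identityʳ _)))
multiple-bracket {a} (suc (suc b)) 1≤a _ with multiple-bracket (suc b) 1≤a (s≤s z≤n)
... | q , qa<b , b≤ with suc (suc b) ≤? suc q * a
...   | yes b+1≤ = q , ≤-trans qa<b (n≤1+n (suc b)) , b+1≤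
...   | no  b+1≰ = suc q , ≰⇒> b+1≰ , ≤-trans (s≤s b≤) (+-monoˡ-≤ (suc q * a) 1≤a)

toℕ-inject₁-fromℕ : ∀ n → toℕ (inject₁ (fromℕ n)) ≡ n
toℕ-inject₁-fromℕ n = trans (toℕ-inject₁ (fromℕ n)) (toℕ-fromℕ n)

Prefix : (ℕ → ℕ) → ℕ → CoinPred
Prefix c n = InSub c {n} ⊤

module CompletelyGreedySequence {c : ℕ → ℕ} (coin-set : InfCoinSet c) (complete : CompletelyGreedy c) where

  c₀≡1 : c 0 ≡ 1
  c₀≡1 = proj₁ coin-set

  c-inc : StrictlyIncreasing c
  c-inc = proj₂ coin-set

  open Increasing c-inc public

  1≤c : ∀ j → 1 ≤ c j
  1≤c j = ≤-trans (s≤s z≤n) (n<c[n] (≤-reflexive (sym c₀≡1)) j)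

  Prefix-∋ : ∀ {n j} → j < n → Prefix c n (c j)
  Prefix-∋ j<n = fromℕ< j<n , ∈⊤ , cong c (toℕ-fromℕ< j<n)

  InSub-below-next : ∀ {n j y} {s : Subset n} → InSub c s y → y < c (suc j) → y ≤ c j
  InSub-below-next (i , _ , refl) ci<c[j+1] = mono-≤ (≤-pred (cancel-< ci<c[j+1]))

  prefix-greedy : ∀ n → IsGreedy (Prefix c (suc n))
  prefix-greedy n = complete (suc n) ⊤ (Fin.zero , ∈⊤ , c₀≡1)

  -- A representation of N < c (suc n) uses only the first suc n coins, where greediness applies.
  greedy-length-≤ : ∀ {n N g r} → 1 ≤ N → N < c (suc n) →
                    GreedyRep (Prefix c (suc n)) N g → Rep (InSeq c) N r → length g ≤ length r
  greedy-length-≤ {n} {N} {g} {r} 1≤N N<c greedy (r∈C , Σr≡N) =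
    prefix-greedy n N 1≤N g greedy r (restrict r r∈C (subst (_< c (suc n)) (sym Σr≡N) N<c) , Σr≡N)
    where
    restrict : ∀ r → All (InSeq c) r → sum r < c (suc n) → All (Prefix c (suc n)) r
    restrict []      []                  _  = []
    restrict (x ∷ r) ((i , refl) ∷ r∈C) lt =
      Prefix-∋ (cancel-< (≤-<-trans (m≤m+n x (sum r)) lt)) ∷ restrict r r∈C (≤-<-trans (m≤n+m (sum r) x) lt)

  three-coins : ∀ j → Subset (suc (suc j))
  three-coins j = ⁅ Fin.zero ⁆ ∪ (⁅ inject₁ (fromℕ j) ⁆ ∪ ⁅ fromℕ (suc j) ⁆)

  three-coins-∋-1 : ∀ j → InSub c (three-coins j) 1
  three-coins-∋-1 j = Fin.zero , x∈p∪q⁺ (inj₁ (x∈⁅x⁆ Fin.zero)) , c₀≡1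

  three-coins-greedy : ∀ j → IsGreedy (InSub c (three-coins j))
  three-coins-greedy j = complete (suc (suc j)) (three-coins j) (three-coins-∋-1 j)

  three-coins-∋-c[j] : ∀ j → InSub c (three-coins j) (c j)
  three-coins-∋-c[j] j = inject₁ (fromℕ j) , x∈p∪q⁺ (inj₂ (x∈p∪q⁺ (inj₁ (x∈⁅x⁆ _)))) , cong c (toℕ-inject₁-fromℕ j)

  three-coins-∋-c[j+1] : ∀ j → InSub c (three-coins j) (c (suc j))
  three-coins-∋-c[j+1] j = fromℕ (suc j) , x∈p∪q⁺ (inj₂ (x∈p∪q⁺ (inj₂ (x∈⁅x⁆ _)))) , cong c (toℕ-fromℕ (suc j))

  three-coins⊆ : ∀ j y → InSub c (three-coins j) y → y ≡ 1 ⊎ y ≡ c j ⊎ y ≡ c (suc j)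
  three-coins⊆ j y (i , i∈ , refl) with x∈p∪q⁻ ⁅ Fin.zero ⁆ _ i∈
  ... | inj₁ i∈₀ = inj₁ (trans (cong (c ∘ toℕ) (x∈⁅y⁆⇒x≡y Fin.zero i∈₀)) c₀≡1)
  ... | inj₂ i∈₁₂ with x∈p∪q⁻ ⁅ inject₁ (fromℕ j) ⁆ _ i∈₁₂
  ...   | inj₁ i∈₁ = inj₂ (inj₁ (cong c (trans (cong toℕ (x∈⁅y⁆⇒x≡y _ i∈₁)) (toℕ-inject₁-fromℕ j))))
  ...   | inj₂ i∈₂ = inj₂ (inj₂ (cong c (trans (cong toℕ (x∈⁅y⁆⇒x≡y _ i∈₂)) (toℕ-fromℕ (suc j)))))

  -- Three-coin greediness is needed only when c (suc j) ≤ 3 c j; otherwise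
  -- l = ⌈c (suc j) / c j⌉ − 2 already satisfies both bounds.
  consecutive-ratio : ∀ j → ∃ λ l → 1 ≤ l × l * c j + c j ≤ c (suc j) + 2 × c (suc j) ≤ 2 ^ l * c j
  consecutive-ratio j with multiple-bracket (c (suc j)) (1≤c j) (1≤c (suc j))
  ... | zero  , _    , b≤a = contradiction (c-inc j) (≤⇒≯ (≤-trans b≤a (≤-reflexive (+-identityʳ (c j)))))
  ... | suc p , qa<b , b≤  with p ≤? 1
  ...   | yes p≤1 = suc p , s≤s z≤n , bound , ≤-trans b≤ (*-monoˡ-≤ (c j) (n<2^n (suc p)))
    where
    open ≤-Reasoning
    bound : suc p * c j + c j ≤ c (suc j) + 2
    bound = begin
      suc p * c j + c j   ≡⟨ +-comm (suc p * c j) (c j) ⟩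
      suc (suc p) * c j   ≤⟨ three-coin-bound (three-coins-greedy j) (three-coins-∋-1 j) (three-coins-∋-c[j] j)
                               (three-coins-∋-c[j+1] j) (three-coins⊆ j) (c-inc j) qa<b b≤ ⟩
      c (suc j) + suc p   ≤⟨ +-monoʳ-≤ (c (suc j)) (s≤s p≤1) ⟩
      c (suc j) + 2       ∎
  ...   | no  p≰1 = p , ≤-trans (s≤s z≤n) (≰⇒> p≰1) , bound , ≤-trans b≤ (*-monoˡ-≤ (c j) (2+n≤2^n p (≰⇒> p≰1)))
    where
    bound : p * c j + c j ≤ c (suc j) + 2
    bound = ≤-trans (≤-reflexive (+-comm (p * c j) (c j))) (≤-trans (<⇒≤ qa<b) (m≤m+n (c (suc j)) 2))

  module Blocks (a n : ℕ) where

    -- An amount Σ_{a ≤ j < a + D} l_j ⋅ c j, built with the l_j of consecutive-ratio,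
    -- together with its greedy representation in the first n coins.
    record Block (D : ℕ) : Set where
      field
        value       : ℕ
        coins       : List ℕ
        greedy      : GreedyRep (Prefix c n) value coins
        value-bound : value + c a ≤ c (a + D) + 2 * D
        top-bound   : c (a + D) ≤ 2 ^ length coins * c a
        doubling    : 2 ^ D ≤ suc value

    empty-block : Block 0
    empty-block = record
      { value       = 0
      ; coins       = []
      ; greedy      = done
      ; value-bound = ≤-reflexive (trans (cong c (sym (+-identityʳ a))) (sym (+-identityʳ (c (a + 0)))))
      ; top-bound   = ≤-reflexive (trans (cong c (+-identityʳ a)) (sym (+-identityʳ (c a))))
      ; doubling    = ≤-refl
      }

    extend : ∀ {D} → a + D < n → 2 * suc D < c a → Block D → Block (suc D)
    extend {D} j<n 2[D+1]<ca B with consecutive-ratio (a + D)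
    ... | l , 1≤l , ratio-sum , ratio-pow = record
      { value       = l * c j + value
      ; coins       = replicate l (c j) ++ coins
      ; greedy      = GreedyRep-replicate l (1≤c j) (Prefix-∋ j<n) maximal greedy
      ; value-bound = subst (λ x → l * c j + value + c a ≤ x + 2 * suc D) (sym c[a+D+1]≡c[j+1]) bound
      ; top-bound   = subst (_≤ 2 ^ length (replicate l (c j) ++ coins) * c a) (sym c[a+D+1]≡c[j+1]) top
      ; doubling    = doubled
      }
      where
      open Block B
      open ≤-Reasoning
      j = a + D
      c[a+D+1]≡c[j+1] : c (a + suc D) ≡ c (suc j)
      c[a+D+1]≡c[j+1] = cong c (+-suc a D)
      value<c[j] : value < c j
      value<c[j] = +-cancelʳ-< (c a) value (c j)
        (≤-<-trans value-bound (+-monoʳ-< (c j) (≤-<-trans (*-monoʳ-≤ 2 (n≤1+n D)) 2[D+1]<ca)))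
      bound : l * c j + value + c a ≤ c (suc j) + 2 * suc D
      bound = begin
        l * c j + value + c a    ≡⟨ +-assoc (l * c j) value (c a) ⟩
        l * c j + (value + c a)  ≤⟨ +-monoʳ-≤ (l * c j) value-bound ⟩
        l * c j + (c j + 2 * D)  ≡⟨ +-assoc (l * c j) (c j) (2 * D) ⟨
        l * c j + c j + 2 * D    ≤⟨ +-monoˡ-≤ (2 * D) ratio-sum ⟩
        c (suc j) + 2 + 2 * D    ≡⟨ +-assoc (c (suc j)) 2 (2 * D) ⟩
        c (suc j) + (2 + 2 * D)  ≡⟨ cong (c (suc j) +_) (*-suc 2 D) ⟨
        c (suc j) + 2 * suc D    ∎
      below-next : l * c j + value < c (suc j)
      below-next = +-cancelʳ-< (c a) (l * c j + value) (c (suc j)) (≤-<-trans bound (+-monoʳ-< (c (suc j)) 2[D+1]<ca))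
      maximal : ∀ y → Prefix c n y → y ≤ l * c j + value → y ≤ c j
      maximal y y∈P y≤ = InSub-below-next y∈P (≤-<-trans y≤ below-next)
      top : c (suc j) ≤ 2 ^ length (replicate l (c j) ++ coins) * c a
      top = begin
        c (suc j)                          ≤⟨ ratio-pow ⟩
        2 ^ l * c j                        ≤⟨ *-monoʳ-≤ (2 ^ l) top-bound ⟩
        2 ^ l * (2 ^ length coins * c a)   ≡⟨ *-assoc (2 ^ l) (2 ^ length coins) (c a) ⟨
        2 ^ l * 2 ^ length coins * c a     ≡⟨ cong (_* c a) (^-distribˡ-+-* 2 l (length coins)) ⟨
        2 ^ (l + length coins) * c a       ≡⟨ cong (λ m → 2 ^ m * c a) (trans (length-++ (replicate l (c j))) (cong (_+ length coins) (length-replicate l))) ⟨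
        2 ^ length (replicate l (c j) ++ coins) * c a ∎
      doubled : 2 ^ suc D ≤ suc (l * c j + value)
      doubled = begin
        2 * 2 ^ D                ≤⟨ *-monoʳ-≤ 2 doubling ⟩
        2 * suc value            ≡⟨ 2*x≡x+x (suc value) ⟩
        suc value + suc value    ≡⟨ cong suc (+-comm value (suc value)) ⟩
        suc (suc value + value)  ≤⟨ s≤s (+-monoˡ-≤ value (≤-trans value<c[j] (m≤n*m (c j) l ⦃ >-nonZero 1≤l ⦄))) ⟩
        suc (l * c j + value)    ∎

    block : ∀ D → a + D ≤ n → 2 * D < c a → Block D
    block zero    _        _       = empty-block
    block (suc D) a+D+1≤n 2D+2<ca = extend (subst (_≤ n) (+-suc a D) a+D+1≤n) 2D+2<ca
      (block D (≤-trans (+-monoʳ-≤ a (n≤1+n D)) a+D+1≤n) (≤-<-trans (*-monoʳ-≤ 2 (n≤1+n D)) 2D+2<ca))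

⌊x/2⌋<y : ∀ x y → x < 2 * y → ⌊ x /2⌋ < y
⌊x/2⌋<y zero          (suc y) _        = s≤s z≤n
⌊x/2⌋<y (suc zero)    (suc y) _        = s≤s z≤n
⌊x/2⌋<y (suc (suc x)) (suc y) (s≤s x+1<) =
  s≤s (⌊x/2⌋<y x y (≤-pred (subst (suc (suc x) ≤_) (+-suc y (y + 0)) x+1<)))

⌊log₂⌋≤ : ∀ T x → x < 2 ^ suc T → ⌊log₂ x ⌋ ≤ T
⌊log₂⌋≤ zero    x x<2      = ≤-trans (⌊log₂⌋-mono-≤ (≤-pred x<2)) (≤-reflexive (⌊log₂[2^n]⌋≡n 0))
⌊log₂⌋≤ (suc T) x x<2^T+2 = ≤-trans (m≤n+m∸n ⌊log₂ x ⌋ 1) (s≤s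
  (subst (_≤ T) (⌊log₂⌊n/2⌋⌋≡⌊log₂n⌋∸1 x) (⌊log₂⌋≤ T ⌊ x /2⌋ (⌊x/2⌋<y x (2 ^ suc T) x<2^T+2))))

≤⌊log₂⌋ : ∀ E x → 2 ^ E ≤ x → E ≤ ⌊log₂ x ⌋
≤⌊log₂⌋ E x 2^E≤x = subst (_≤ ⌊log₂ x ⌋) (⌊log₂[2^n]⌋≡n E) (⌊log₂⌋-mono-≤ 2^E≤x)

2^[2+E]≤1+x⇒2^E≤x∸1 : ∀ E x → 2 ^ (2 + E) ≤ suc x → 2 ^ E ≤ x ∸ 1
2^[2+E]≤1+x⇒2^E≤x∸1 E x 2^[2+E]≤ = ∸-monoˡ-≤ 2 (≤-trans 2+p≤4p 2^[2+E]≤)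
  where
  p = 2 ^ E
  2+p≤4p : 2 + p ≤ 2 * (2 * p)
  2+p≤4p = ≤-trans (+-mono-≤ (*-monoʳ-≤ 2 (m^n>0 2 E)) (m≤m+n p (p + 0))) (≤-reflexive (sym (2*x≡x+x (2 * p))))

power-of-2-bracket : ∀ x → 1 ≤ x → ∃ λ A → x ≤ 2 ^ A × 2 ^ A < 2 * x
power-of-2-bracket (suc zero)    _ = 0 , ≤-refl , s≤s (s≤s z≤n)
power-of-2-bracket (suc (suc x)) _ with power-of-2-bracket (suc x) (s≤s z≤n)
... | A , x+1≤2^A , 2^A<2x+2 with suc (suc x) ≤? 2 ^ A
...   | yes x+2≤2^A = A , x+2≤2^A , ≤-trans 2^A<2x+2 (*-monoʳ-≤ 2 (n≤1+n (suc x)))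
...   | no  x+2≰2^A = suc A , x+2≤2^A+1 , *-monoʳ-< 2 (≰⇒> x+2≰2^A)
  where
  x+2≤2^A+1 : suc (suc x) ≤ 2 * 2 ^ A
  x+2≤2^A+1 = ≤-trans (s≤s (m≤n+m (suc x) x)) (≤-trans (≤-reflexive (sym (2*x≡x+x (suc x)))) (*-monoʳ-≤ 2 x+1≤2^A))

linear≤exponential : ∀ C → ∃ λ B → ∀ A → B ≤ A → C * suc A ≤ 2 ^ A
linear≤exponential C = C + suc C , λ A B≤A → eventually (≤⇒≤′ B≤A)
  where
  open ≤-Reasoning
  eventually : ∀ {A} → C + suc C ≤′ A → C * suc A ≤ 2 ^ A
  eventually ≤′-refl = begin
    C * (suc C + suc C)  ≤⟨ *-mono-≤ (<⇒≤ (n<2^n C)) (≤-trans (≤-reflexive (sym (2*x≡x+x (suc C)))) (*-monoʳ-≤ 2 (n<2^n C))) ⟩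
    2 ^ C * 2 ^ suc C    ≡⟨ ^-distribˡ-+-* 2 C (suc C) ⟨
    2 ^ (C + suc C)      ∎
  eventually {suc A} (≤′-step B≤A) = begin
    C * suc (suc A)  ≡⟨ *-suc C (suc A) ⟩
    C + C * suc A    ≤⟨ +-mono-≤ (≤-trans (m≤m*n C (suc A)) (eventually B≤A)) (eventually B≤A) ⟩
    2 ^ A + 2 ^ A    ≡⟨ 2*x≡x+x (2 ^ A) ⟨
    2 ^ suc A        ∎

exponent-selection : ∀ C → ∃ λ X → ∀ x → X ≤ x → ∃ λ A → C * (2 + A) < x × x ≤ 2 ^ suc A
exponent-selection C with linear≤exponential (2 * C)
... | B , lin = suc (2 ^ B) , select
  where
  select : ∀ x → suc (2 ^ B) ≤ x → ∃ λ A → C * (2 + A) < x × x ≤ 2 ^ suc A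
  select x 2^B<x with power-of-2-bracket x (≤-trans (s≤s z≤n) 2^B<x)
  ... | A₀ , x≤2^A₀ , 2^A₀<2x with B <? A₀
  ...   | no  B≮A₀ = contradiction (≤-trans x≤2^A₀ (^-monoʳ-≤ 2 (≮⇒≥ B≮A₀))) (<⇒≱ 2^B<x)
  ...   | yes (s≤s {n = A} B≤A) = A , *-cancelˡ-< 2 (C * (2 + A)) x
      (≤-<-trans (≤-trans (≤-reflexive (sym (*-assoc 2 C (2 + A)))) (lin (suc A) (m≤n⇒m≤1+n B≤A))) 2^A₀<2x) , x≤2^A₀

log-factor : ℕ → ℕ
log-factor N = ⌊log₂ (N ∸ 1) ⌋ + 2

module _ {c : ℕ → ℕ} (coin-set : InfCoinSet c) (complete : CompletelyGreedy c)
         {o : ℕ → ℕ} (opt : ∀ k → 1 ≤ k → IsOpt (InSeq c) k (o k)) where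

  open CompletelyGreedySequence coin-set complete

  module _ (k A a : ℕ) (2D<ca : 2 * (suc k * (2 + A)) < c a) (ca≤2^[1+A] : c a ≤ 2 ^ suc A) where

    open Blocks a (suc (a + suc k * (2 + A)))

    -- Stated for an arbitrary block: checking it against the concrete one would unfold the
    -- whole construction.
    block-near-log-factor : (B : Block (suc k * (2 + A))) → let N = Block.value B in
                            a ≤ N × 2 ≤ N × suc k * log-factor N ≤ suc k * o N + log-factor N
    block-near-log-factor B = a≤S , 2≤S , near
      where
      open ≤-Reasoning
      open Block B renaming (value to S; coins to g)
      K E D : ℕ
      K = suc k
      -- D unfolds to suc k * (2 + A); this form exposes 2 ^ D = 4 ⋅ 2 ^ E.
      E = A + k * (2 + A)
      D = 2 + E
      S<c[a+D] : S < c (a + D)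
      S<c[a+D] = +-cancelʳ-< (c a) S (c (a + D)) (≤-<-trans value-bound (+-monoʳ-< (c (a + D)) 2D<ca))
      2≤S : 2 ≤ S
      2≤S = ≤-trans (n≤1+n 2) (≤-pred (≤-trans (^-monoʳ-≤ 2 {2} {D} (s≤s (s≤s z≤n))) doubling))
      a≤S : a ≤ S
      a≤S = ≤-pred (begin
        suc a          ≤⟨ n<c[n] (≤-reflexive (sym c₀≡1)) a ⟩
        c a            ≤⟨ ca≤2^[1+A] ⟩
        2 ^ suc A      ≤⟨ ^-monoʳ-≤ 2 (m≤n⇒m≤1+n (s≤s (m≤m+n A (k * (2 + A))))) ⟩
        2 ^ D          ≤⟨ doubling ⟩
        suc S          ∎)
      greedy≤opt : length g ≤ o S
      greedy≤opt with proj₁ (opt S (≤-trans (s≤s z≤n) 2≤S))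
      ... | r , rep , |r|≡oS =
        subst (length g ≤_) |r|≡oS (greedy-length-≤ (≤-trans (s≤s z≤n) 2≤S) (<-trans S<c[a+D] (c-inc (a + D))) greedy rep)
      log-upper : log-factor S ≤ length g + (2 + A)
      log-upper = begin
        ⌊log₂ (S ∸ 1) ⌋ + 2    ≤⟨ +-monoˡ-≤ 2 (⌊log₂⌋≤ (length g + A) (S ∸ 1) (begin-strict
          S ∸ 1                         ≤⟨ m∸n≤m S 1 ⟩
          S                             <⟨ S<c[a+D] ⟩
          c (a + D)                     ≤⟨ top-bound ⟩
          2 ^ length g * c a            ≤⟨ *-monoʳ-≤ (2 ^ length g) ca≤2^[1+A] ⟩
          2 ^ length g * 2 ^ suc A      ≡⟨ ^-distribˡ-+-* 2 (length g) (suc A) ⟨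
          2 ^ (length g + suc A)        ≡⟨ cong (2 ^_) (+-suc (length g) A) ⟩
          2 ^ suc (length g + A)        ∎)) ⟩
        length g + A + 2        ≡⟨ +-assoc (length g) A 2 ⟩
        length g + (A + 2)      ≡⟨ cong (length g +_) (+-comm A 2) ⟩
        length g + (2 + A)      ∎
      log-lower : D ≤ log-factor S
      log-lower = ≤-trans (≤-reflexive (+-comm 2 E)) (+-monoˡ-≤ 2 (≤⌊log₂⌋ E (S ∸ 1) (2^[2+E]≤1+x⇒2^E≤x∸1 E S doubling)))
      near : K * log-factor S ≤ K * o S + log-factor S
      near = begin
        K * log-factor S             ≤⟨ *-monoʳ-≤ K log-upper ⟩
        K * (length g + (2 + A))     ≡⟨ *-distribˡ-+ K (length g) (2 + A) ⟩
        K * length g + D             ≤⟨ +-monoʳ-≤ (K * length g) log-lower ⟩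
        K * length g + log-factor S  ≤⟨ +-monoˡ-≤ (log-factor S) (*-monoʳ-≤ K greedy≤opt) ⟩
        K * o S + log-factor S       ∎

    near-log-factor-above : ∃ λ N → a ≤ N × 2 ≤ N × suc k * log-factor N ≤ suc k * o N + log-factor N
    near-log-factor-above = _ , block-near-log-factor (block (suc k * (2 + A)) (n≤1+n _) 2D<ca)

  opt-near-log-factor : ∀ k M → ∃ λ N → M ≤ N × 2 ≤ N × suc k * log-factor N ≤ suc k * o N + log-factor N
  opt-near-log-factor k M with exponent-selection (2 * suc k)
  ... | X , select with select (c (X + M)) (≤-trans (m≤m+n X M) (<⇒≤ (n<c[n] (≤-reflexive (sym c₀≡1)) (X + M))))
  ... | A , 2K[2+A]<ca , ca≤2^[1+A] =
    let N , a≤N , 2≤N , near = near-log-factor-above k A (X + M) (subst (_< c (X + M)) (*-assoc 2 (suc k) (2 + A)) 2K[2+A]<ca) ca≤2^[1+A]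
    in N , ≤-trans (m≤n+m M X) a≤N , 2≤N , near

denom-bound : ∀ {o} → Subadditive o → ∀ k N → suc k * log-factor N ≤ suc k * o N + log-factor N →
              suc k * denom N ≤ 2 * suc k * cost o N + 2 * denom N
denom-bound {o} sub k N near = begin
  K * (L * N)                ≡⟨ *-assoc K L N ⟨
  K * L * N                  ≤⟨ *-monoˡ-≤ N near ⟩
  (K * o N + L) * N          ≡⟨ *-distribʳ-+ N (K * o N) L ⟩
  K * o N * N + L * N        ≡⟨ cong (_+ L * N) (trans (*-assoc K (o N) N) (cong (K *_) (*-comm (o N) N))) ⟩
  K * (N * o N) + L * N      ≤⟨ +-mono-≤ (*-monoʳ-≤ K (N*o[N]≤2*cost[N] sub N)) (m≤m+n (L * N) (L * N + 0)) ⟩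
  K * (2 * cost o N) + 2 * (L * N) ≡⟨ cong (_+ 2 * (L * N)) (trans (sym (*-assoc K 2 (cost o N))) (cong (_* cost o N) (*-comm K 2))) ⟩
  2 * K * cost o N + 2 * (L * N)   ∎
  where
  open ≤-Reasoning
  K = suc k
  L = log-factor N

theorem7 : (c : ℕ → ℕ) → InfCoinSet c → CompletelyGreedy c →
           (o : ℕ → ℕ) → (∀ k → 1 ≤ k → IsOpt (InSeq c) k (o k)) →
           ∀ (k M : ℕ) → ∃ λ N → M ≤ N × 2 ≤ N ×
             suc k * denom N ≤ 2 * suc k * cost o N + 2 * denom N
theorem7 c coin-set complete o opt k M =
  let N , M≤N , 2≤N , near = opt-near-log-factor coin-set complete opt k M
  in N , M≤N , 2≤N , denom-bound (IsOpt-subadditive opt) k N near
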